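{- Let $k$ and $n\ge 3$ be odd integers. Then the $k$-coprime graph $\mathrm{CP}(k,n)$ is Hamiltonian.
   Context: For an integer $k$ and a positive integer $n$, $\mathrm{CP}(k,n)$ is the simple graph with vertex set $\{k,k+1,\ldots,k+n-1\}$ in which two distinct vertices $a,b$ are adjacent if and only if $\gcd(a,b)=1$ (with $\gcd(a,0)=|a|$). A graph is Hamiltonian if it contains a cycle through every vertex exactly once. -}

module Defs where

open import Data.Nat as ℕ using (ℕ; suc; _≤_)
open import Data.Integer as ℤ using (ℤ; +_)
open import Data.Integer.GCD as ℤG using ()
open import Data.Nat.DivMod using (m%n<n)
open import Data.Fin as Fin using (Fin; toℕ)
open import Data.Product using (∃; _×_)
open import Relation.Binary.PropositionalEquality using (_≡_; _≢_)
open import Function.Definitions using (Injective)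

Oddℤ : ℤ → Set
Oddℤ k = ∃ λ (m : ℤ) → k ≡ (+ 2) ℤ.* m ℤ.+ (+ 1)

Oddℕ : ℕ → Set
Oddℕ n = ∃ λ (m : ℕ) → n ≡ 2 ℕ.* m ℕ.+ 1

record Graph (n : ℕ) : Set₁ where
  field
    Adj : Fin n → Fin n → Set

open Graph public

nextMod : ∀ {m} → Fin (suc m) → Fin (suc m)
nextMod {m} i = Fin.fromℕ< (m%n<n (suc (toℕ i)) (suc m))

-- A Hamiltonian cycle: a cyclic ordering v₀, v₁, …, v_{n-1} of all vertices
-- (an injective, hence bijective, map Fin n → vertices) such that consecutive
-- vertices v_i, v_{i+1 mod n} are adjacent.  We require n ≥ 3 so that this is a
-- genuine cycle in a simple graph.
Hamiltonian : ∀ {n} → Graph n → Set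
Hamiltonian {0} G = Data.Empty.⊥
  where import Data.Empty
Hamiltonian {suc m} G =
  (3 ≤ suc m) × ∃ λ (v : Fin (suc m) → Fin (suc m)) →
     Injective _≡_ _≡_ v × (∀ i → Adj G (v i) (v (nextMod i)))

-- The k-coprime graph CP(k,n): vertex i ∈ Fin n represents the integer k + i;
-- distinct vertices a, b adjacent iff gcd(a,b) = 1 (gcd(a,0) = |a|, as in stdlib).
CP : ℤ → (n : ℕ) → Graph n
Adj (CP k n) i j = (i ≢ j) × (ℤG.gcd (k ℤ.+ + toℕ i) (k ℤ.+ + toℕ j) ≡ + 1)

module Submission where

-- Vertices are handled as offsets i ∈ {0, …, N} (standing for k + i), n = N + 1, and the
-- case split is on g = gcd(k + 1, L) where L = N - 1 is odd (so g is odd):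
--   * g = 1: 1, N, N-1, …, 2, 0 is a Hamiltonian cycle (`fold-cycle`);
--   * g = h ≥ 5: then h ∣ k + 1 and L = (2M+1)·h, and a "snake" through the grid with rows of
--     length h works, its vertical steps i → i + h joining values ≡ c - 1 (mod h) with c - 1
--     coprime to h (`Snake`);
--   * g = 3: the reflection i ↦ N - i turns CP(k, n) into CP(k′, n), k′ = -(k + N), and
--     gcd(k′ + 1, L) ≠ 3 (`reflect`, `not-both-3`).
-- Only three kinds of edges occur: consecutive integers, odd integers two apart, and the
-- vertical steps of the snake.

open import Defs
open import Data.Nat as ℕ using (ℕ; zero; suc; _+_; _*_; _∸_; _≤_; _<_; _≥_; z≤n; s≤s)
import Data.Nat.Properties as ℕP
open import Data.Nat.Divisibility
  using (_∣_; divides; _∣0; ∣-refl; ∣-trans; ∣1⇒≡1; 0∣⇒≡0; ∣⇒≤; ∣m∣n⇒∣m+n; ∣m+n∣m⇒∣n; m∣m*n; ∣n⇒∣m*n)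
import Data.Nat.GCD as ℕG
open import Data.Nat.DivMod using (_%_; m%n<n; m<n⇒m%n≡m; n%n≡0)
import Data.Nat.Tactic.RingSolver as ℕRing
open import Data.Integer as ℤ using (ℤ; +_)
import Data.Integer.Properties as ℤP
import Data.Integer.GCD as ℤG
open import Data.Integer.Divisibility.Signed as ℤD using (∣ᵤ⇒∣; ∣⇒∣ᵤ) renaming (_∣_ to _∣ᶻ_)
import Data.Integer.Tactic.RingSolver as ℤRing
open import Data.Fin using (Fin; toℕ; fromℕ<; opposite; #_)
open import Data.Fin.Properties using (toℕ-injective; toℕ<n; toℕ-fromℕ<; opposite-prop; opposite-involutive)
open import Data.Vec using ([]) renaming (_∷_ to _∷ᵥ_)
open import Data.List using (List; []; _∷_; _++_; _∷ʳ_; length)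
import Data.List.Properties as ListP
open import Data.List.Membership.Propositional using (_∈_)
import Data.List.Relation.Unary.All as All
open import Data.List.Relation.Unary.AllPairs using ([]; _∷_)
open import Data.List.Relation.Unary.Any using (here; there)
open import Data.List.Relation.Unary.Unique.Propositional using (Unique)
open import Data.List.Relation.Binary.Permutation.Propositional
  using (_↭_; ↭-refl; ↭-sym; prep; swap; ↭⇒↭ₛ; module PermutationReasoning)
import Data.List.Relation.Binary.Permutation.Propositional.Properties as ↭
import Data.List.Relation.Binary.Permutation.Setoid.Properties as ↭ₛ
open import Data.Product using (_×_; _,_; proj₁; proj₂)
open import Data.Sum using (_⊎_; inj₁; inj₂)
open import Data.Empty using (⊥-elim)
open import Relation.Nullary using (¬_; yes; no)
open import Relation.Binary.PropositionalEquality

odd-not-even : ∀ {n} → Oddℕ n → ¬ 2 ∣ n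
odd-not-even (m , refl) 2∣n with ∣⇒≤ (∣m+n∣m⇒∣n 2∣n (m∣m*n m))
... | s≤s ()

odd-positive : ∀ {n} → Oddℕ n → 1 ≤ n
odd-positive (m , refl) = ℕP.m≤n+m 1 (2 * m)

odd-2+ : ∀ {n} → Oddℕ n → Oddℕ (2 + n)
odd-2+ (m , refl) = suc m , shape m
  where
  shape : ∀ m → 2 + (2 * m + 1) ≡ 2 * suc m + 1
  shape = ℕRing.solve-∀

parity : ∀ n → 2 ∣ n ⊎ Oddℕ n
parity zero = inj₁ (2 ∣0)
parity (suc zero) = inj₂ (0 , refl)
parity (suc (suc n)) with parity n
... | inj₁ 2∣n = inj₁ (∣m∣n⇒∣m+n (∣-refl {2}) 2∣n)
... | inj₂ n-odd = inj₂ (odd-2+ n-odd)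

odd-divisor : ∀ {d n} → d ∣ n → Oddℕ n → Oddℕ d
odd-divisor {d} d∣n n-odd with parity d
... | inj₁ 2∣d = ⊥-elim (odd-not-even n-odd (∣-trans 2∣d d∣n))
... | inj₂ d-odd = d-odd

divisors-of-2 : ∀ {d} → d ∣ 2 → d ≡ 1 ⊎ d ≡ 2
divisors-of-2 {0} 0∣2 with () ← 0∣⇒≡0 0∣2
divisors-of-2 {1} _ = inj₁ refl
divisors-of-2 {2} _ = inj₂ refl
divisors-of-2 {suc (suc (suc d))} d∣2 with ∣⇒≤ d∣2
... | s≤s (s≤s ())

odd+even-odd : ∀ {k} → Oddℤ k → ∀ {a} → 2 ∣ a → ¬ (+ 2 ∣ᶻ k ℤ.+ + a)
odd+even-odd (m , refl) (divides c refl) 2∣x = odd-not-even (0 , refl) (∣⇒∣ᵤ 2∣1)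
  where
  shape : ∀ m c → + 2 ℤ.* m ℤ.+ + 1 ℤ.+ c ℤ.* + 2 ≡ + 2 ℤ.* (m ℤ.+ c) ℤ.+ + 1
  shape = ℤRing.solve-∀
  2∣2[m+c]+1 : + 2 ∣ᶻ + 2 ℤ.* (m ℤ.+ + c) ℤ.+ + 1
  2∣2[m+c]+1 = subst (+ 2 ∣ᶻ_) (trans (cong (λ z → + 2 ℤ.* m ℤ.+ + 1 ℤ.+ z) (ℤP.pos-* c 2)) (shape m (+ c))) 2∣x
  2∣1 : + 2 ∣ᶻ + 1
  2∣1 = ℤD.∣m+n∣m⇒∣n 2∣2[m+c]+1 (ℤD.∣m⇒∣m*n (m ℤ.+ + c) ℤD.∣-refl)

Edge : ℤ → ℕ → ℕ → Set
Edge k a b = a ≢ b × ℤG.gcd (k ℤ.+ + a) (k ℤ.+ + b) ≡ + 1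

edge-sym : ∀ {k a b} → Edge k a b → Edge k b a
edge-sym {k} {a} {b} (a≢b , g) = (λ b≡a → a≢b (sym b≡a)) , trans (ℤG.gcd-comm (k ℤ.+ + b) (k ℤ.+ + a)) g

-- A common divisor of x and x + e divides e; so x and x + e are coprime as soon as
-- x shares no divisor > 1 with the gap e.
edge-by-gap : ∀ k a e → (∀ {d} → d ∣ suc e → + d ∣ᶻ k ℤ.+ + a → d ≡ 1) → Edge k a (a + suc e)
edge-by-gap k a e′ coprime = (λ a≡a+e → ℕP.m+1+n≢m a (sym a≡a+e)) , cong +_ (coprime g∣e g∣x)
  where
  e = suc e′
  x = k ℤ.+ + a
  g = ℕG.gcd ℤ.∣ x ∣ ℤ.∣ k ℤ.+ + (a + e) ∣
  x+e : k ℤ.+ + (a + e) ≡ x ℤ.+ + e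
  x+e = sym (ℤP.+-assoc k (+ a) (+ e))
  g∣x : + g ∣ᶻ x
  g∣x = ∣ᵤ⇒∣ (ℤG.gcd[i,j]∣i x (k ℤ.+ + (a + e)))
  g∣e : g ∣ e
  g∣e = ∣⇒∣ᵤ (ℤD.∣m+n∣m⇒∣n (subst (+ g ∣ᶻ_) x+e (∣ᵤ⇒∣ (ℤG.gcd[i,j]∣j x (k ℤ.+ + (a + e))))) g∣x)

edge-suc : ∀ k a → Edge k a (suc a)
edge-suc k a = subst (Edge k a) (ℕP.+-comm a 1) (edge-by-gap k a 0 (λ d∣1 _ → ∣1⇒≡1 d∣1))

edge-two : ∀ k a → ¬ (+ 2 ∣ᶻ k ℤ.+ + a) → Edge k a (a + 2)
edge-two k a odd = edge-by-gap k a 1 only-1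
  where
  only-1 : ∀ {d} → d ∣ 2 → + d ∣ᶻ k ℤ.+ + a → d ≡ 1
  only-1 d∣2 d∣x with divisors-of-2 d∣2
  ... | inj₁ d≡1 = d≡1
  ... | inj₂ refl = ⊥-elim (odd d∣x)

-- If h ∣ k + 1 then k + (q·h + c) ≡ c - 1 (mod h): the "vertical" pairs
-- (q·h + c, (q+1)·h + c) are edges whenever c - 1 is coprime to h.
module Columns (k : ℤ) (h′ : ℕ) (h∣k+1 : + suc h′ ∣ᶻ k ℤ.+ + 1) where

  h : ℕ
  h = suc h′

  private
    d∣k+1+qh : ∀ {d} q → d ∣ h → + d ∣ᶻ (k ℤ.+ + 1) ℤ.+ + (q * h)
    d∣k+1+qh q d∣h = ℤD.∣m∣n⇒∣m+n (ℤD.∣-trans (∣ᵤ⇒∣ d∣h) h∣k+1) (∣ᵤ⇒∣ (∣n⇒∣m*n q d∣h))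

    regroup : ∀ (k x c : ℤ) → k ℤ.+ (x ℤ.+ (+ 1 ℤ.+ c)) ≡ ((k ℤ.+ + 1) ℤ.+ x) ℤ.+ c
    regroup = ℤRing.solve-∀

    regroup₀ : ∀ (k x : ℤ) → (k ℤ.+ + 1) ℤ.+ x ≡ (k ℤ.+ x) ℤ.+ + 1
    regroup₀ = ℤRing.solve-∀

    next-row : ∀ q h c → q * h + c + h ≡ suc q * h + c
    next-row = ℕRing.solve-∀

  column-edge : ∀ q c → (∀ {d} → d ∣ h → d ∣ c → d ≡ 1) → Edge k (q * h + suc c) (suc q * h + suc c)
  column-edge q c coprime = subst (Edge k (q * h + suc c)) (next-row q h (suc c)) (edge-by-gap k (q * h + suc c) h′ only-1)
    where
    only-1 : ∀ {d} → d ∣ h → + d ∣ᶻ k ℤ.+ + (q * h + suc c) → d ≡ 1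
    only-1 d∣h d∣x = coprime d∣h (∣⇒∣ᵤ (ℤD.∣m+n∣m⇒∣n (subst (+ _ ∣ᶻ_) (regroup k (+ (q * h)) (+ c)) d∣x) (d∣k+1+qh q d∣h)))

  column-edge₀ : ∀ q → Edge k (q * h) (suc q * h)
  column-edge₀ q = subst (Edge k (q * h)) (ℕP.+-comm (q * h) h) (edge-by-gap k (q * h) h′ only-1)
    where
    only-1 : ∀ {d} → d ∣ h → + d ∣ᶻ k ℤ.+ + (q * h) → d ≡ 1
    only-1 d∣h d∣x = ∣1⇒≡1 (∣⇒∣ᵤ (ℤD.∣m+n∣m⇒∣n (subst (+ _ ∣ᶻ_) (regroup₀ k (+ (q * h))) (d∣k+1+qh q d∣h)) d∣x))

run : ℕ → ℕ → List ℕ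
run a zero = []
run a (suc n) = a ∷ run (suc a) n

down : ℕ → ℕ → List ℕ
down a zero = []
down a (suc n) = a + n ∷ down a n

run-++ : ∀ a m n {b} → a + m ≡ b → run a m ++ run b n ≡ run a (m + n)
run-++ a zero n a+0≡b = cong (λ z → run z n) (trans (sym a+0≡b) (ℕP.+-identityʳ a))
run-++ a (suc m) n a+1+m≡b = cong (a ∷_) (run-++ (suc a) m n (trans (sym (ℕP.+-suc a m)) a+1+m≡b))

run-snoc : ∀ a n → run a (suc n) ≡ run a n ∷ʳ (a + n)
run-snoc a n = trans (cong (run a) (ℕP.+-comm 1 n)) (sym (run-++ a n 1 refl))

down↭run : ∀ a n → down a n ↭ run a n
down↭run a zero = ↭-refl
down↭run a (suc n) = begin
  a + n ∷ down a n  ↭⟨ prep (a + n) (down↭run a n) ⟩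
  a + n ∷ run a n   ↭⟨ ↭.∷↭∷ʳ (a + n) (run a n) ⟩
  run a n ∷ʳ (a + n) ≡⟨ sym (run-snoc a n) ⟩
  run a (suc n)     ∎
  where open PermutationReasoning

run-bounds : ∀ {x} a n → x ∈ run a n → a ≤ x × x < a + n
run-bounds a (suc n) (here refl) = ℕP.≤-refl , ℕP.m<m+n a (s≤s z≤n)
run-bounds {x} a (suc n) (there x∈) with run-bounds (suc a) n x∈
... | a<x , x<1+a+n = ℕP.<⇒≤ a<x , subst (x <_) (sym (ℕP.+-suc a n)) x<1+a+n

length-run : ∀ a n → length (run a n) ≡ n
length-run a zero = refl
length-run a (suc n) = cong suc (length-run (suc a) n)


run-unique : ∀ a n → Unique (run a n)
run-unique a zero = []
run-unique a (suc n) = All.tabulate (λ x∈ a≡x → ℕP.<⇒≢ (proj₁ (run-bounds (suc a) n x∈)) a≡x) ∷ run-unique (suc a) n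

interleave : ∀ (a₁ a₂ a₃ a₄ a₅ : List ℕ) → a₁ ++ (a₃ ++ (a₅ ++ (a₄ ++ a₂))) ↭ (a₁ ++ a₂) ++ ((a₃ ++ a₄) ++ a₅)
interleave a₁ a₂ a₃ a₄ a₅ =
  prove 5 (x₁ ⊕ (x₃ ⊕ (x₅ ⊕ (x₄ ⊕ x₂)))) ((x₁ ⊕ x₂) ⊕ ((x₃ ⊕ x₄) ⊕ x₅)) (a₁ ∷ᵥ a₂ ∷ᵥ a₃ ∷ᵥ a₄ ∷ᵥ a₅ ∷ᵥ [])
  where
  open import Algebra.Solver.CommutativeMonoid (↭.++-commutativeMonoid {A = ℕ})
  x₁ = var (# 0)
  x₂ = var (# 1)
  x₃ = var (# 2)
  x₄ = var (# 3)
  x₅ = var (# 4)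

data Path (E : ℕ → ℕ → Set) : ℕ → ℕ → List ℕ → Set where
  stop : ∀ a → Path E a a (a ∷ [])
  step : ∀ {a b c xs} → E a b → Path E b c xs → Path E a c (a ∷ xs)

path-++ : ∀ {E a b c d xs ys} → Path E a b xs → E b c → Path E c d ys → Path E a d (xs ++ ys)
path-++ (stop a) e q = step e q
path-++ (step e′ p) e q = step e′ (path-++ p e q)

path-run : ∀ k a n → Path (Edge k) a (a + n) (run a (suc n))
path-run k a zero = subst (λ b → Path (Edge k) a b (a ∷ [])) (sym (ℕP.+-identityʳ a)) (stop a)
path-run k a (suc n) = step (edge-suc k a) (subst (λ b → Path (Edge k) (suc a) b (run (suc a) (suc n))) (sym (ℕP.+-suc a n)) (path-run k (suc a) n))

path-down : ∀ k a n → Path (Edge k) (a + n) a (down a (suc n))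
path-down k a zero = subst (λ b → Path (Edge k) b a (b ∷ [])) (sym (ℕP.+-identityʳ a)) (stop a)
path-down k a (suc n) = step (subst (λ b → Edge k b (a + n)) (sym (ℕP.+-suc a n)) (edge-sym {k} (edge-suc k (a + n)))) (path-down k a n)

record HamCycle (k : ℤ) (N : ℕ) : Set where
  field
    vertices : List ℕ
    first last : ℕ
    path : Path (Edge k) first last vertices
    closing : Edge k last first
    spanning : vertices ↭ run 0 (suc N)

-- Positional access to a list of naturals (0 past the end).
_!_ : List ℕ → ℕ → ℕ
[] ! _ = 0
(x ∷ xs) ! zero = x
(x ∷ xs) ! suc i = xs ! i

!-∈ : ∀ xs {i} → i < length xs → xs ! i ∈ xs
!-∈ (x ∷ xs) {zero} _ = here refl
!-∈ (x ∷ xs) {suc i} (s≤s i<) = there (!-∈ xs i<)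

!-injective : ∀ {xs} → Unique xs → ∀ {i j} → i < length xs → j < length xs → xs ! i ≡ xs ! j → i ≡ j
!-injective (_ ∷ _) {zero} {zero} _ _ _ = refl
!-injective {x ∷ xs} (x∉ ∷ _) {zero} {suc j} _ (s≤s j<) x≡ = ⊥-elim (All.lookup x∉ (!-∈ xs j<) x≡)
!-injective {x ∷ xs} (x∉ ∷ _) {suc i} {zero} (s≤s i<) _ ≡x = ⊥-elim (All.lookup x∉ (!-∈ xs i<) (sym ≡x))
!-injective (_ ∷ u) {suc i} {suc j} (s≤s i<) (s≤s j<) eq = cong suc (!-injective u i< j< eq)

path-first : ∀ {E a b xs} → Path E a b xs → xs ! 0 ≡ a
path-first (stop a) = refl
path-first (step _ _) = refl

path-last : ∀ {E a b xs} → Path E a b xs → ∀ {i} → suc i ≡ length xs → xs ! i ≡ b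
path-last (stop a) {zero} refl = refl
path-last (step _ (stop _)) {suc zero} refl = refl
path-last (step _ p@(step _ _)) {suc i} eq = path-last p (ℕP.suc-injective eq)

path-edge : ∀ {E a b xs} → Path E a b xs → ∀ {i} → suc i < length xs → E (xs ! i) (xs ! suc i)
path-edge (stop _) {zero} (s≤s ())
path-edge {E} (step {a} e p) {zero} _ = subst (E a) (sym (path-first p)) e
path-edge (step _ p) {suc i} (s≤s i<) = path-edge p i<

hamiltonian-of-cycle : ∀ {k N} → HamCycle k N → 2 ≤ N → Hamiltonian (CP k (suc N))
hamiltonian-of-cycle {k} {N} c 2≤N = s≤s 2≤N , v , v-injective , v-adjacent
  where
  open HamCycle c
  len : length vertices ≡ suc N
  len = trans (↭.↭-length spanning) (length-run 0 (suc N))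
  distinct : Unique vertices
  distinct = ↭ₛ.Unique-resp-↭ (setoid ℕ) (↭⇒↭ₛ (↭-sym spanning)) (run-unique 0 (suc N))
  in-range : (i : Fin (suc N)) → toℕ i < length vertices
  in-range i = subst (toℕ i <_) (sym len) (toℕ<n i)
  bounded : (i : Fin (suc N)) → vertices ! toℕ i < suc N
  bounded i = proj₂ (run-bounds 0 (suc N) (↭.∈-resp-↭ spanning (!-∈ vertices (in-range i))))
  v : Fin (suc N) → Fin (suc N)
  v i = fromℕ< (bounded i)
  toℕ-v : ∀ i → toℕ (v i) ≡ vertices ! toℕ i
  toℕ-v i = toℕ-fromℕ< (bounded i)
  v-injective : ∀ {i j} → v i ≡ v j → i ≡ j
  v-injective {i} {j} vi≡vj = toℕ-injective (!-injective distinct (in-range i) (in-range j)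
    (trans (sym (toℕ-v i)) (trans (cong toℕ vi≡vj) (toℕ-v j))))
  adjacent : ∀ i j → Edge k (vertices ! toℕ i) (vertices ! toℕ j) → Adj (CP k (suc N)) (v i) (v j)
  adjacent i j (ne , g) = (λ vi≡vj → ne (trans (sym (toℕ-v i)) (trans (cong toℕ vi≡vj) (toℕ-v j))))
    , subst₂ (λ x y → ℤG.gcd (k ℤ.+ + x) (k ℤ.+ + y) ≡ + 1) (sym (toℕ-v i)) (sym (toℕ-v j)) g
  toℕ-next : ∀ i → toℕ (nextMod i) ≡ suc (toℕ i) % suc N
  toℕ-next i = toℕ-fromℕ< (m%n<n (suc (toℕ i)) (suc N))
  v-adjacent : ∀ i → Adj (CP k (suc N)) (v i) (v (nextMod i))
  v-adjacent i with ℕP.m≤n⇒m<n∨m≡n (ℕ.s≤s⁻¹ (toℕ<n i))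
  ... | inj₁ i<N = adjacent i (nextMod i)
      (subst (λ z → Edge k (vertices ! toℕ i) (vertices ! z)) (sym next≡suc)
        (path-edge path (subst (suc (toℕ i) <_) (sym len) (s≤s i<N))))
    where
    next≡suc : toℕ (nextMod i) ≡ suc (toℕ i)
    next≡suc = trans (toℕ-next i) (m<n⇒m%n≡m (s≤s i<N))
  ... | inj₂ i≡N = adjacent i (nextMod i)
      (subst₂ (λ x z → Edge k x (vertices ! z)) (sym at-last) (sym next≡0)
        (subst (Edge k last) (sym (path-first path)) closing))
    where
    next≡0 : toℕ (nextMod i) ≡ 0
    next≡0 = trans (toℕ-next i) (trans (cong (λ z → suc z % suc N) i≡N) (n%n≡0 (suc N)))
    at-last : vertices ! toℕ i ≡ last
    at-last = path-last path (trans (cong suc i≡N) (sym len))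

-- Reflection i ↦ N - i maps the vertex k + i of CP k (N + 1) to the negative of the vertex
-- k′ + i of CP k′ (N + 1), k′ = -(k + N); negation preserves gcd, so the graphs are isomorphic.
reflect : ∀ k N → Hamiltonian (CP (ℤ.- (k ℤ.+ + N)) (suc N)) → Hamiltonian (CP k (suc N))
reflect k N (3≤n , w , w-injective , w-adjacent) = 3≤n , v , v-injective , v-adjacent
  where
  k′ = ℤ.- (k ℤ.+ + N)
  v : Fin (suc N) → Fin (suc N)
  v i = opposite (w i)
  opposite-injective : ∀ {x y : Fin (suc N)} → opposite x ≡ opposite y → x ≡ y
  opposite-injective {x} {y} eq = trans (sym (opposite-involutive x)) (trans (cong opposite eq) (opposite-involutive y))
  v-injective : ∀ {i j} → v i ≡ v j → i ≡ j
  v-injective eq = w-injective (opposite-injective eq)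
  negate : ∀ (k n a : ℤ) → k ℤ.+ (n ℤ.- a) ≡ ℤ.- (ℤ.- (k ℤ.+ n) ℤ.+ a)
  negate = ℤRing.solve-∀
  reflected-value : ∀ (x : Fin (suc N)) → k ℤ.+ + toℕ (opposite x) ≡ ℤ.- (k′ ℤ.+ + toℕ x)
  reflected-value x = begin
    k ℤ.+ + toℕ (opposite x)    ≡⟨ cong (λ z → k ℤ.+ + z) (opposite-prop x) ⟩
    k ℤ.+ + (N ∸ toℕ x)         ≡⟨ cong (λ z → k ℤ.+ z) (trans (sym (ℤP.≤-⊖ (ℕ.s≤s⁻¹ (toℕ<n x)))) (sym (ℤP.m-n≡m⊖n N (toℕ x)))) ⟩
    k ℤ.+ (+ N ℤ.- + toℕ x)     ≡⟨ negate k (+ N) (+ toℕ x) ⟩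
    ℤ.- (k′ ℤ.+ + toℕ x)        ∎
    where open ≡-Reasoning
  v-adjacent : ∀ i → Adj (CP k (suc N)) (v i) (v (nextMod i))
  v-adjacent i with w-adjacent i
  ... | x≢y , g = (λ eq → x≢y (opposite-injective eq)) , (begin
    ℤG.gcd (k ℤ.+ + toℕ (v i)) (k ℤ.+ + toℕ (v (nextMod i)))
      ≡⟨ cong₂ ℤG.gcd (reflected-value (w i)) (reflected-value (w (nextMod i))) ⟩
    ℤG.gcd (ℤ.- (k′ ℤ.+ + toℕ (w i))) (ℤ.- (k′ ℤ.+ + toℕ (w (nextMod i))))
      ≡⟨ cong₂ (λ a b → + ℕG.gcd a b) (ℤP.∣-i∣≡∣i∣ (k′ ℤ.+ + toℕ (w i))) (ℤP.∣-i∣≡∣i∣ (k′ ℤ.+ + toℕ (w (nextMod i)))) ⟩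
    ℤG.gcd (k′ ℤ.+ + toℕ (w i)) (k′ ℤ.+ + toℕ (w (nextMod i)))
      ≡⟨ g ⟩
    + 1 ∎)
    where open ≡-Reasoning

shiftedGcd : ℤ → ℕ → ℕ
shiftedGcd k L = ℕG.gcd ℤ.∣ k ℤ.+ + 1 ∣ L

shiftedGcd∣k+1 : ∀ k L → + shiftedGcd k L ∣ᶻ k ℤ.+ + 1
shiftedGcd∣k+1 k L = ∣ᵤ⇒∣ (ℕG.gcd[m,n]∣m ℤ.∣ k ℤ.+ + 1 ∣ L)

shiftedGcd∣L : ∀ k L → shiftedGcd k L ∣ L
shiftedGcd∣L k L = ℕG.gcd[m,n]∣n ℤ.∣ k ℤ.+ + 1 ∣ L

-- If k + 1 is coprime to N - 1 = L + 1, then 1, N, N-1, …, 2, 0 is a Hamiltonian cycle of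
-- CP k (N + 1): the jump 1 → N is an edge because gcd(k+1, k+N) divides both k+1 and N-1,
-- and 2 → 0 joins the odd numbers k + 2 and k.
fold-cycle : ∀ {k} → Oddℤ k → ∀ L → shiftedGcd k (suc L) ≡ 1 → HamCycle k (2 + L)
fold-cycle {k} k-odd L coprime = record
  { vertices = 1 ∷ (down 2 (suc L) ++ 0 ∷ [])
  ; first = 1
  ; last = 0
  ; path = step jump (path-++ (path-down k 2 L) (edge-sym {k} (edge-two k 0 (odd+even-odd k-odd (2 ∣0)))) (stop 0))
  ; closing = edge-suc k 0
  ; spanning = spanning
  }
  where
  jump : Edge k 1 (1 + suc L)
  jump = edge-by-gap k 1 L (λ d∣L+1 d∣k+1 → ∣1⇒≡1 (subst (_ ∣_) coprime (ℕG.gcd-greatest (∣⇒∣ᵤ d∣k+1) d∣L+1)))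
  spanning : 1 ∷ (down 2 (suc L) ++ 0 ∷ []) ↭ run 0 (3 + L)
  spanning = begin
    1 ∷ (down 2 (suc L) ∷ʳ 0)  ↭⟨ prep 1 (↭-sym (↭.∷↭∷ʳ 0 (down 2 (suc L)))) ⟩
    1 ∷ 0 ∷ down 2 (suc L)     ↭⟨ swap 1 0 (down↭run 2 (suc L)) ⟩
    0 ∷ 1 ∷ run 2 (suc L)      ∎
    where open PermutationReasoning

-- Arrange the offsets 0, …, N in rows q·h + c (0 ≤ c < h); the top row 2M+1 holds only
-- c = 0, 1.  Columns 0, 1, 2 are climbed upwards, columns 3, …, h-1 descended on the way
-- back.  Vertical steps happen only in the columns c = 0, 2, 3, h-1, where c - 1 is
-- coprime to h (as h is odd), so `Columns` applies.
module Snake (k : ℤ) (k-odd : Oddℤ k) (u : ℕ) (h∣k+1 : + (5 + 2 * u) ∣ᶻ k ℤ.+ + 1) where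

  open Columns k (4 + 2 * u) h∣k+1 using (h; column-edge; column-edge₀)

  -- length of the descending part of a row: columns 3, …, h - 1
  r : ℕ
  r = 2 + 2 * u

  -- the vertex in the last column h - 1 of row q
  lastCol : ℕ → ℕ
  lastCol q = q * h + 3 + suc (2 * u)

  h-odd : ¬ 2 ∣ h
  h-odd = odd-not-even (2 + u , shape u)
    where
    shape : ∀ u → 5 + 2 * u ≡ 2 * (2 + u) + 1
    shape = ℕRing.solve-∀

  private
    only-1 : ∀ {d} → d ∣ h → d ∣ 2 → d ≡ 1
    only-1 d∣h d∣2 with divisors-of-2 d∣2
    ... | inj₁ d≡1 = d≡1
    ... | inj₂ refl = ⊥-elim (h-odd d∣h)

  column-2 : ∀ q → Edge k (q * h + 2) (suc q * h + 2)
  column-2 q = column-edge q 1 (λ _ d∣1 → ∣1⇒≡1 d∣1)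

  column-3 : ∀ q → Edge k (q * h + 3) (suc q * h + 3)
  column-3 q = column-edge q 2 only-1

  column-last : ∀ q → Edge k (lastCol q) (lastCol (suc q))
  column-last q = subst₂ (Edge k) (sym (ℕP.+-assoc (q * h) 3 (suc (2 * u)))) (sym (ℕP.+-assoc (suc q * h) 3 (suc (2 * u))))
    (column-edge q (3 + 2 * u) (λ {d} d∣h d∣h-2 → only-1 d∣h (∣m+n∣m⇒∣n (subst (d ∣_) (ℕP.+-comm 2 (3 + 2 * u)) d∣h) d∣h-2)))

  -- The part of the snake starting at row q and covering rows q, q+1, …, q+2M: it climbs
  -- columns 0–2 to the top row (two vertices) and comes back through columns 3 … h-1.
  climb : ℕ → ℕ → List ℕ
  climb zero q = run (q * h) 2
  climb (suc M) q = run (q * h) 3 ++ (down (h + q * h) 3 ++ (climb M (2 + q) ++ (down (h + q * h + 3) r ++ run (q * h + 3) r)))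

  climb-end : ℕ → ℕ → ℕ
  climb-end zero q = q * h + 1
  climb-end (suc M) q = lastCol q

  -- Leaving an (odd) row q + 1 to the last column of row q: a vertical step, or, from the
  -- top row, the step of 2 between the even offsets lastCol q and (q + 1)·h + 1.
  climb-exit : ∀ M q → Oddℕ (suc q) → Edge k (climb-end M (suc q)) (lastCol q)
  climb-exit (suc M) q _ = edge-sym {k} (column-last q)
  climb-exit zero q (j , 1+q≡2j+1) = subst (λ z → Edge k z (lastCol q)) top (edge-sym {k} (edge-two k (lastCol q) (odd+even-odd k-odd even)))
    where
    top : lastCol q + 2 ≡ suc q * h + 1
    top = shape q u
      where
      shape : ∀ q u → q * (5 + 2 * u) + 3 + suc (2 * u) + 2 ≡ suc q * (5 + 2 * u) + 1
      shape = ℕRing.solve-∀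
    q≡2j : q ≡ 2 * j
    q≡2j = ℕP.suc-injective (trans 1+q≡2j+1 (ℕP.+-comm (2 * j) 1))
    even : 2 ∣ lastCol q
    even = divides (j * h + 2 + u) (subst (λ z → lastCol z ≡ (j * h + 2 + u) * 2) (sym q≡2j) (shape j u))
      where
      shape : ∀ j u → 2 * j * (5 + 2 * u) + 3 + suc (2 * u) ≡ (j * (5 + 2 * u) + 2 + u) * 2
      shape = ℕRing.solve-∀

  -- Along climb M q consecutive vertices are adjacent (q odd keeps the exit parities right).
  climb-path : ∀ M q → Oddℕ q → Path (Edge k) (q * h) (climb-end M q) (climb M q)
  climb-path zero q _ = path-run k (q * h) 1
  climb-path (suc M) q q-odd =
    path-++ (path-run k (q * h) 2) (column-2 q)
    (path-++ (path-down k (h + q * h) 2) (column-edge₀ (suc q))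
    (path-++ (climb-path M (2 + q) 2+q-odd) (climb-exit M (suc q) 2+q-odd)
    (path-++ (path-down k (h + q * h + 3) (suc (2 * u))) (edge-sym {k} (column-3 q))
             (path-run k (q * h + 3) (suc (2 * u))))))
    where
    2+q-odd : Oddℕ (2 + q)
    2+q-odd = odd-2+ q-odd

  climb-spans : ∀ M q → climb M q ↭ run (q * h) (M * (2 * h) + 2)
  climb-spans zero q = ↭-refl
  climb-spans (suc M) q = begin
    run X 3 ++ (down Y 3 ++ (climb M (2 + q) ++ (down (Y + 3) r ++ run (X + 3) r)))
      ↭⟨ ↭.++⁺ˡ (run X 3) (↭.++⁺ (down↭run Y 3) (↭.++⁺ (climb-spans M (2 + q)) (↭.++⁺ʳ (run (X + 3) r) (down↭run (Y + 3) r)))) ⟩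
    run X 3 ++ (run Y 3 ++ (run (h + Y) L ++ (run (Y + 3) r ++ run (X + 3) r)))
      ↭⟨ interleave (run X 3) (run (X + 3) r) (run Y 3) (run (Y + 3) r) (run (h + Y) L) ⟩
    (run X 3 ++ run (X + 3) r) ++ ((run Y 3 ++ run (Y + 3) r) ++ run (h + Y) L)
      ≡⟨ cong₂ _++_ (run-++ X 3 r refl) (trans (cong (_++ run (h + Y) L) (run-++ Y 3 r refl)) (run-++ Y h L (ℕP.+-comm Y h))) ⟩
    run X h ++ run Y (h + L)
      ≡⟨ run-++ X h (h + L) (ℕP.+-comm X h) ⟩
    run X (h + (h + L))
      ≡⟨ cong (run X) (size M h) ⟩
    run X (suc M * (2 * h) + 2) ∎
    where
    open PermutationReasoning
    X = q * h
    Y = h + q * h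
    L = M * (2 * h) + 2
    size : ∀ M h → h + (h + (M * (2 * h) + 2)) ≡ suc M * (2 * h) + 2
    size = ℕRing.solve-∀

  -- The whole snake: row 0's columns 2, 1, 0, then climb M 1, back along row 0's
  -- columns h-1, …, 3, and finally 3 → 2.
  snake-cycle : ∀ M → HamCycle k (suc ((2 * M + 1) * h))
  snake-cycle M = record
    { vertices = down 0 3 ++ (climb M 1 ++ down 3 r)
    ; first = 2
    ; last = 3
    ; path = path-++ (path-down k 0 2) (column-edge₀ 0)
             (path-++ (climb-path M 1 (0 , refl)) (climb-exit M 0 (0 , refl)) (path-down k 3 (suc (2 * u))))
    ; closing = edge-sym {k} (edge-suc k 2)
    ; spanning = spanning
    }
    where
    L = M * (2 * h) + 2
    size : ∀ M h → h + (M * (2 * h) + 2) ≡ suc (suc ((2 * M + 1) * h))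
    size = ℕRing.solve-∀
    spanning : down 0 3 ++ (climb M 1 ++ down 3 r) ↭ run 0 (suc (suc ((2 * M + 1) * h)))
    spanning = begin
      down 0 3 ++ (climb M 1 ++ down 3 r)   ↭⟨ ↭.++⁺ (down↭run 0 3) (↭.++⁺ (climb-spans M 1) (down↭run 3 r)) ⟩
      run 0 3 ++ (run (1 * h) L ++ run 3 r) ↭⟨ ↭.++⁺ˡ (run 0 3) (↭.++-comm (run (1 * h) L) (run 3 r)) ⟩
      run 0 3 ++ (run 3 r ++ run (1 * h) L) ≡⟨ sym (ListP.++-assoc (run 0 3) (run 3 r) (run (1 * h) L)) ⟩
      run 0 h ++ run (1 * h) L              ≡⟨ run-++ 0 h L (sym (ℕP.*-identityˡ h)) ⟩
      run 0 (h + L)                         ≡⟨ cong (run 0) (size M h) ⟩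
      run 0 (suc (suc ((2 * M + 1) * h)))   ∎
      where open PermutationReasoning

-- The snake case: gcd(k + 1, L) = h = 5 + 2u divides k + 1 and L, and L / h is odd as L is.
snake-hamiltonian : ∀ {k} → Oddℤ k → ∀ L → Oddℕ L → ∀ u → shiftedGcd k L ≡ 5 + 2 * u → Hamiltonian (CP k (2 + L))
snake-hamiltonian {k} k-odd L L-odd u g≡h =
  hamiltonian-of-cycle (subst (HamCycle k) (cong suc (sym L≡[2M+1]h)) (snake-cycle M)) (s≤s (odd-positive L-odd))
  where
  h = 5 + 2 * u
  open Snake k k-odd u (subst (λ g → + g ∣ᶻ k ℤ.+ + 1) g≡h (shiftedGcd∣k+1 k L)) using (snake-cycle)
  h∣L : h ∣ L
  h∣L = subst (_∣ L) g≡h (shiftedGcd∣L k L)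
  q = _∣_.quotient h∣L
  q∣L : q ∣ L
  q∣L = divides h (trans (_∣_.equality h∣L) (ℕP.*-comm q h))
  M = proj₁ (odd-divisor q∣L L-odd)
  L≡[2M+1]h : L ≡ (2 * M + 1) * h
  L≡[2M+1]h = trans (_∣_.equality h∣L) (cong (_* h) (proj₂ (odd-divisor q∣L L-odd)))

-- For odd k and odd L, CP k (L + 2) is Hamiltonian unless gcd(k + 1, L) = 3: that gcd is
-- odd, and is either 1 (fold cycle) or at least 5 (snake).
hamiltonian-unless-3 : ∀ {k} → Oddℤ k → ∀ L → Oddℕ L → shiftedGcd k L ≢ 3 → Hamiltonian (CP k (2 + L))
hamiltonian-unless-3 k-odd zero L-odd _ = ⊥-elim (odd-not-even L-odd (2 ∣0))
hamiltonian-unless-3 {k} k-odd (suc L) L-odd g≢3 with odd-divisor (shiftedGcd∣L k (suc L)) L-odd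
... | zero , g≡1 = hamiltonian-of-cycle (fold-cycle k-odd L g≡1) (s≤s (s≤s z≤n))
... | suc zero , g≡3 = ⊥-elim (g≢3 g≡3)
... | suc (suc u) , g≡2[2+u]+1 = snake-hamiltonian k-odd (suc L) L-odd u (trans g≡2[2+u]+1 (shape u))
  where
  shape : ∀ u → 2 * suc (suc u) + 1 ≡ 5 + 2 * u
  shape = ℕRing.solve-∀

odd-reflection : ∀ {k N} → Oddℤ k → 2 ∣ N → Oddℤ (ℤ.- (k ℤ.+ + N))
odd-reflection {N = N} (a , refl) (divides c refl) =
  ℤ.- a ℤ.- + c ℤ.- + 1 , trans (cong (λ z → ℤ.- (+ 2 ℤ.* a ℤ.+ + 1 ℤ.+ z)) (ℤP.pos-* c 2)) (shape a (+ c))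
  where
  shape : ∀ a c → ℤ.- (+ 2 ℤ.* a ℤ.+ + 1 ℤ.+ c ℤ.* + 2) ≡ + 2 ℤ.* (ℤ.- a ℤ.- c ℤ.- + 1) ℤ.+ + 1
  shape = ℤRing.solve-∀

-- gcd(k + 1, L) and gcd(k′ + 1, L) with k′ = -(k + L + 1) are never both 3: otherwise 3
-- divides k + 1, L and -(k′ + 1) = k + L, hence k, hence 1.
not-both-3 : ∀ k L → shiftedGcd k L ≡ 3 → shiftedGcd (ℤ.- (k ℤ.+ + suc L)) L ≢ 3
not-both-3 k L g≡3 g′≡3 = 3≢1 (∣1⇒≡1 (∣⇒∣ᵤ 3∣1))
  where
  k′ = ℤ.- (k ℤ.+ + suc L)
  3≢1 : 3 ≢ 1
  3≢1 ()
  3∣k+1 : + 3 ∣ᶻ k ℤ.+ + 1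
  3∣k+1 = subst (λ g → + g ∣ᶻ k ℤ.+ + 1) g≡3 (shiftedGcd∣k+1 k L)
  3∣k′+1 : + 3 ∣ᶻ k′ ℤ.+ + 1
  3∣k′+1 = subst (λ g → + g ∣ᶻ k′ ℤ.+ + 1) g′≡3 (shiftedGcd∣k+1 k′ L)
  3∣L : + 3 ∣ᶻ + L
  3∣L = ∣ᵤ⇒∣ (subst (_∣ L) g≡3 (shiftedGcd∣L k L))
  unreflect : ∀ k l → ℤ.- (ℤ.- (k ℤ.+ (+ 1 ℤ.+ l)) ℤ.+ + 1) ≡ k ℤ.+ l
  unreflect = ℤRing.solve-∀
  3∣k+L : + 3 ∣ᶻ k ℤ.+ + L
  3∣k+L = subst (+ 3 ∣ᶻ_) (trans (cong (λ z → ℤ.- (ℤ.- (k ℤ.+ z) ℤ.+ + 1)) (ℤP.pos-+ 1 L)) (unreflect k (+ L)))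
                (ℤD.∣m⇒∣-m 3∣k′+1)
  3∣1 : + 3 ∣ᶻ + 1
  3∣1 = ℤD.∣m+n∣m⇒∣n 3∣k+1 (ℤD.∣m+n∣n⇒∣m {m = k} 3∣k+L 3∣L)

theorem2p3 : (k : ℤ) (n : ℕ) → Oddℤ k → Oddℕ n → n ≥ 3 → Hamiltonian (CP k n)
theorem2p3 k n k-odd (zero , refl) (s≤s ())
theorem2p3 k n k-odd (suc m , refl) _ = subst (λ n → Hamiltonian (CP k n)) (size m) hamiltonian
  where
  L = 2 * m + 1
  size : ∀ m → 2 + (2 * m + 1) ≡ 2 * suc m + 1
  size = ℕRing.solve-∀
  N-even : 2 ∣ suc L
  N-even = divides (suc m) (shape m)
    where
    shape : ∀ m → suc (2 * m + 1) ≡ suc m * 2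
    shape = ℕRing.solve-∀
  hamiltonian : Hamiltonian (CP k (2 + L))
  hamiltonian with shiftedGcd k L ℕ.≟ 3
  ... | no g≢3 = hamiltonian-unless-3 k-odd L (m , refl) g≢3
  ... | yes g≡3 = reflect k (suc L) (hamiltonian-unless-3 (odd-reflection k-odd N-even) L (m , refl) (not-both-3 k L g≡3))
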